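{- Let $\gamma\in 2\mathbb{Z}_2$ with $2|\gamma|_2<1$. For any integer $m\ge2$, there is a positive integer $k\le\frac{1}{|\gamma|_2}\left(\frac{1}{|\gamma m|_2}+1\right)-2$ such that \[ \mathbb{Z}_2=\{x_1^m+x_2^m+\cdots+x_k^m:\ x_i\in\mathcal{C}_\gamma,\ 1\le i\le k\}. \]
   Context: $\mathbb{Z}_2$ is the ring of $2$-adic integers and $|\cdot|_2$ the $2$-adic absolute value. For $\gamma\in 2\mathbb{Z}_2$ with $2|\gamma|_2<1$, $\mathcal{C}_\gamma=\left\{\sum_{n=0}^\infty a_n\gamma^n:\ a_n\in\{0,\gamma-1\}\right\}\subseteq\mathbb{Z}_2$. -}

module Defs where

open import Data.Nat using (ℕ; zero; suc; _+_; _*_; _∸_; _^_; _<_; _%_; NonZero)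
open import Data.Nat.Divisibility using (_∣_)
open import Data.Bool using (Bool; true; false; if_then_else_)
open import Data.Fin using (Fin)
open import Data.Product using (_×_)
open import Relation.Binary.PropositionalEquality using (_≡_)
open import Relation.Nullary using (¬_)
open import Data.Nat.Properties using (m^n≢0)

_mod2^_ : ℕ → ℕ → ℕ
x mod2^ n = _%_ x (2 ^ n) {{m^n≢0 2 n}}

-- 2-adic integers as coherent sequences of residues: res n is x mod 2^n.
record ℤ₂ : Set where
  field
    res      : ℕ → ℕ
    res-<    : ∀ n → res n < 2 ^ n
    res-coh  : ∀ n → res (suc n) mod2^ n ≡ res n
open ℤ₂ public

-- 2-adic valuation of a 2-adic integer: v₂(x) = v, i.e. |x|₂ = 2^(-v)
-- (x ≡ 0 mod 2^v but x ≢ 0 mod 2^(v+1)); implies x ≠ 0.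
HasVal₂ : ℤ₂ → ℕ → Set
HasVal₂ x v = (res x v ≡ 0) × ¬ (res x (suc v) ≡ 0)

NatVal₂ : ℕ → ℕ → Set
NatVal₂ m w = (2 ^ w ∣ m) × ¬ (2 ^ suc w ∣ m)

sumBelow : ℕ → (ℕ → ℕ) → ℕ
sumBelow zero    f = 0
sumBelow (suc n) f = sumBelow n f + f n

sumFin : (k : ℕ) → (Fin k → ℕ) → ℕ
sumFin zero    f = 0
sumFin (suc k) f = f Fin.zero + sumFin k (λ i → f (Fin.suc i))

-- An element of C_γ is given by its digit choice d : ℕ → Bool
-- (a_n = γ - 1 if d n = true, a_n = 0 otherwise).
-- Its residue mod 2^N: since 2 ∣ γ, γ^n ≡ 0 mod 2^N for n ≥ N, so
-- Σ_{n≥0} a_n γ^n ≡ Σ_{n<N} a_n γ^n (mod 2^N).  Here (γ - 1) mod 2^N is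
-- represented by γ_N + 2^N - 1 with γ_N = res γ N.
Cval : ℤ₂ → (ℕ → Bool) → ℕ → ℕ
Cval γ d N =
  sumBelow N (λ n → if d n then (res γ N + (2 ^ N ∸ 1)) * (res γ N ^ n) else 0)
    mod2^ N

{-# OPTIONS --safe #-}
module Submission where

-- Write v = v₂(γ) and m = 2^w·o with o odd.  An element of C_γ is (γ − 1)·T with T a sum of
-- distinct powers of γ.  We use K = 2^v − 1 principal summands (γ − 1)·Tᵢ with
-- Tᵢ = 1 + Σ_{n : i < D n} γ^(n+2), and 2^(w+2v) − 1 summands equal to γ − 1 or 0, which
-- makes k = 2^v(2^(v+w) + 1) − 2.  Since Tᵢ ≡ 1 mod 2^(2v), (Tᵢ + γ^p)^m ≡ Tᵢ^m + m·γ^p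
-- mod 2^(w+(p+1)v), and m·γ^p is 2^(w+pv) times an odd number.  Hence adding γ^p to the
-- first d principal summands changes the sum of m-th powers by d·2^(w+pv)·ω with ω odd,
-- and one d < 2^v matches the target x in the next v binary digits.  The number of
-- summands equal to γ − 1 matches the lowest w + 2v digits; choosing D 0, D 1, … in turn
-- matches x modulo every power of 2.

open import Data.Bool using (Bool; true; false; if_then_else_)
open import Data.Empty using (⊥-elim)
open import Data.Fin as Fin using (Fin; toℕ; _↑ˡ_; _↑ʳ_; splitAt)
open import Data.Fin.Properties using (splitAt-↑ˡ; splitAt-↑ʳ)
open import Data.Integer using (ℤ; +_; -_; -[1+_])
  renaming (_+_ to _+ᶻ_; _*_ to _*ᶻ_; _-_ to _-ᶻ_; _^_ to _^ᶻ_)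
open import Data.Integer.DivMod using (_%ℕ_; _/ℕ_; a≡a%ℕn+[a/ℕn]*n; n%ℕd<d)
open import Data.Integer.Divisibility.Signed
import Data.Integer.Properties as ℤ
open import Data.Integer.Tactic.RingSolver using (solve-∀)
open import Data.Nat using (ℕ; zero; suc; _+_; _*_; _∸_; _^_; _≤_; _<_; z≤n; s≤s; _<?_; _≟_; _%_; _/_)
open import Data.Nat.DivMod
  using (m≡m%n+[m/n]*n; m%n<n; m<n*o⇒m/o<n; m<n⇒m%n≡m; m∣n⇒o%n%m≡o%m; [m+kn]%n≡m%n)
import Data.Nat.Divisibility as ℕᵈ
import Data.Nat.Properties as ℕ
import Data.Nat.Tactic.RingSolver as ℕ-Solver
open import Data.Product using (Σ; _×_; _,_; proj₁; proj₂)
open import Data.Sum using (_⊎_; inj₁; inj₂; [_,_]′)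
open import Relation.Binary.Bundles using (Setoid)
open import Relation.Binary.PropositionalEquality
import Relation.Binary.Reasoning.Setoid as SetoidReasoning
open import Relation.Binary.Structures using (IsEquivalence)
open import Relation.Nullary using (yes; no; does; Dec)
open import Relation.Nullary.Decidable using (dec-true; dec-false)

open import Defs

-- Opaque so that unification can read the exponent e off 2^ᶻ e.
opaque
  2^ᶻ_ : ℕ → ℤ
  2^ᶻ e = + (2 ^ e)

  2^ᶻ-pos : ∀ e → 2^ᶻ e ≡ + (2 ^ e)
  2^ᶻ-pos e = refl

  2^ᶻ-+ : ∀ a b → 2^ᶻ (a + b) ≡ 2^ᶻ a *ᶻ 2^ᶻ b
  2^ᶻ-+ a b = trans (cong +_ (ℕ.^-distribˡ-+-* 2 a b)) (ℤ.pos-* (2 ^ a) (2 ^ b))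

  2^ᶻ-suc : ∀ a → 2^ᶻ suc a ≡ + 2 *ᶻ 2^ᶻ a
  2^ᶻ-suc a = ℤ.pos-* 2 (2 ^ a)

2^ᶻ-mono-∣ : ∀ {a b} → a ≤ b → 2^ᶻ a ∣ 2^ᶻ b
2^ᶻ-mono-∣ {a} a≤b with ℕ.m≤n⇒∃[o]m+o≡n a≤b
... | o , refl = divides (2^ᶻ o) (trans (2^ᶻ-+ a o) (ℤ.*-comm (2^ᶻ a) (2^ᶻ o)))

2^ᶻ-+-suc : ∀ a b → 2^ᶻ (a + suc b) ≡ 2^ᶻ a *ᶻ (+ 2 *ᶻ 2^ᶻ b)
2^ᶻ-+-suc a b = trans (2^ᶻ-+ a (suc b)) (cong (2^ᶻ a *ᶻ_) (2^ᶻ-suc b))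

pos-^ : ∀ a n → + (a ^ n) ≡ (+ a) ^ᶻ n
pos-^ a zero    = refl
pos-^ a (suc n) = trans (ℤ.pos-* a (a ^ n)) (cong (+ a *ᶻ_) (pos-^ a n))

^-distribʳ-* : ∀ a b n → (a *ᶻ b) ^ᶻ n ≡ a ^ᶻ n *ᶻ b ^ᶻ n
^-distribʳ-* a b zero    = refl
^-distribʳ-* a b (suc n) = trans (cong (a *ᶻ b *ᶻ_) (^-distribʳ-* a b n)) (lemma a b (a ^ᶻ n) (b ^ᶻ n))
  where lemma : ∀ a b c d → a *ᶻ b *ᶻ (c *ᶻ d) ≡ a *ᶻ c *ᶻ (b *ᶻ d)
        lemma = solve-∀

2^ᶻ-* : ∀ p v → 2^ᶻ (p * v) ≡ 2^ᶻ v ^ᶻ p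
2^ᶻ-* p v = begin
  2^ᶻ (p * v)      ≡⟨ 2^ᶻ-pos (p * v) ⟩
  + 2 ^ (p * v)    ≡⟨ cong (λ e → + 2 ^ e) (ℕ.*-comm p v) ⟩
  + 2 ^ (v * p)    ≡⟨ cong +_ (ℕ.^-*-assoc 2 v p) ⟨
  + (2 ^ v) ^ p    ≡⟨ pos-^ (2 ^ v) p ⟩
  (+ 2 ^ v) ^ᶻ p   ≡⟨ cong (_^ᶻ p) (2^ᶻ-pos v) ⟨
  2^ᶻ v ^ᶻ p       ∎
  where open ≡-Reasoning

2^ᶻ∣2^* : ∀ a n → 2^ᶻ a ∣ + (2 ^ a * n)
2^ᶻ∣2^* a n = divides (+ n) (trans (ℤ.pos-* (2 ^ a) n) (trans (ℤ.*-comm (+ (2 ^ a)) (+ n)) (cong (+ n *ᶻ_) (sym (2^ᶻ-pos a)))))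

∣-*-2^ᶻ : ∀ {a b x y} → 2^ᶻ a ∣ x → 2^ᶻ b ∣ y → 2^ᶻ (a + b) ∣ x *ᶻ y
∣-*-2^ᶻ {a} {b} (divides p refl) (divides q refl) =
  divides (p *ᶻ q) (trans (lemma p q (2^ᶻ a) (2^ᶻ b)) (cong (p *ᶻ q *ᶻ_) (sym (2^ᶻ-+ a b))))
  where lemma : ∀ p q A B → p *ᶻ A *ᶻ (q *ᶻ B) ≡ p *ᶻ q *ᶻ (A *ᶻ B)
        lemma = solve-∀

pos-2^∸1 : ∀ N → + (2 ^ N ∸ 1) ≡ 2^ᶻ N -ᶻ + 1
pos-2^∸1 N = begin
  + (2 ^ N ∸ 1)               ≡⟨ lemma (+ (2 ^ N ∸ 1)) ⟩
  + suc (2 ^ N ∸ 1) -ᶻ + 1    ≡⟨ cong (λ k → + k -ᶻ + 1) (ℕ.m+[n∸m]≡n (ℕ.m^n>0 2 N)) ⟩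
  + 2 ^ N -ᶻ + 1              ≡⟨ cong (_-ᶻ + 1) (2^ᶻ-pos N) ⟨
  2^ᶻ N -ᶻ + 1                ∎
  where
  open ≡-Reasoning
  lemma : ∀ k → k ≡ + 1 +ᶻ k -ᶻ + 1
  lemma = solve-∀

a-b≡c⇒a≡b+c : ∀ {a b c} → a -ᶻ b ≡ c → a ≡ b +ᶻ c
a-b≡c⇒a≡b+c {a} {b} refl = lemma a b
  where lemma : ∀ a b → a ≡ b +ᶻ (a -ᶻ b)
        lemma = solve-∀

m+k≡n⇒m≤n : ∀ {m n} k → m + k ≡ n → m ≤ n
m+k≡n⇒m≤n {m} k refl = ℕ.m≤m+n m k

-- Congruence modulo 2^e

infix 4 _≡_[mod2^_]
record _≡_[mod2^_] (a b : ℤ) (e : ℕ) : Set where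
  constructor mod
  field 2^e∣a-b : 2^ᶻ e ∣ a -ᶻ b
open _≡_[mod2^_] public

module _ {e : ℕ} where

  private
    ∣-resp : ∀ {a b} → a ≡ b → 2^ᶻ e ∣ a → 2^ᶻ e ∣ b
    ∣-resp = subst (2^ᶻ e ∣_)

  mod-reflexive : ∀ {a b} → a ≡ b → a ≡ b [mod2^ e ]
  mod-reflexive {a} refl = mod (∣-resp (sym (ℤ.+-inverseʳ a)) (divides (+ 0) refl))

  mod-refl : ∀ {a} → a ≡ a [mod2^ e ]
  mod-refl = mod-reflexive refl

  mod-sym : ∀ {a b} → a ≡ b [mod2^ e ] → b ≡ a [mod2^ e ]
  mod-sym {a} {b} (mod p) = mod (∣-resp (lemma a b) (∣m⇒∣-m p))
    where lemma : ∀ a b → - (a -ᶻ b) ≡ b -ᶻ a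
          lemma = solve-∀

  mod-trans : ∀ {a b c} → a ≡ b [mod2^ e ] → b ≡ c [mod2^ e ] → a ≡ c [mod2^ e ]
  mod-trans {a} {b} {c} (mod p) (mod q) = mod (∣-resp (lemma a b c) (∣m∣n⇒∣m+n p q))
    where lemma : ∀ a b c → (a -ᶻ b) +ᶻ (b -ᶻ c) ≡ a -ᶻ c
          lemma = solve-∀

  +-cong-mod : ∀ {a b c d} → a ≡ b [mod2^ e ] → c ≡ d [mod2^ e ] → a +ᶻ c ≡ b +ᶻ d [mod2^ e ]
  +-cong-mod {a} {b} {c} {d} (mod p) (mod q) = mod (∣-resp (lemma a b c d) (∣m∣n⇒∣m+n p q))
    where lemma : ∀ a b c d → (a -ᶻ b) +ᶻ (c -ᶻ d) ≡ a +ᶻ c -ᶻ (b +ᶻ d)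
          lemma = solve-∀

  *-cong-mod : ∀ {a b c d} → a ≡ b [mod2^ e ] → c ≡ d [mod2^ e ] → a *ᶻ c ≡ b *ᶻ d [mod2^ e ]
  *-cong-mod {a} {b} {c} {d} (mod p) (mod q) =
    mod (∣-resp (lemma a b c d) (∣m∣n⇒∣m+n (∣m⇒∣m*n c p) (∣n⇒∣m*n b q)))
    where lemma : ∀ a b c d → (a -ᶻ b) *ᶻ c +ᶻ b *ᶻ (c -ᶻ d) ≡ a *ᶻ c -ᶻ b *ᶻ d
          lemma = solve-∀

  ^-cong-mod : ∀ {a b} n → a ≡ b [mod2^ e ] → a ^ᶻ n ≡ b ^ᶻ n [mod2^ e ]
  ^-cong-mod zero    _   = mod-refl
  ^-cong-mod (suc n) a≡b = *-cong-mod a≡b (^-cong-mod n a≡b)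

  +-congˡ-mod : ∀ a {b c} → b ≡ c [mod2^ e ] → a +ᶻ b ≡ a +ᶻ c [mod2^ e ]
  +-congˡ-mod a = +-cong-mod (mod-refl {a = a})

  *-congˡ-mod : ∀ a {b c} → b ≡ c [mod2^ e ] → a *ᶻ b ≡ a *ᶻ c [mod2^ e ]
  *-congˡ-mod a = *-cong-mod (mod-refl {a = a})

  ∣⇒≡0-mod : ∀ {a} → 2^ᶻ e ∣ a → a ≡ + 0 [mod2^ e ]
  ∣⇒≡0-mod {a} p = mod (∣-resp (sym (ℤ.+-identityʳ a)) p)

  mod-isEquivalence : IsEquivalence _≡_[mod2^ e ]
  mod-isEquivalence = record { refl = mod-refl ; sym = mod-sym ; trans = mod-trans }

mod2^0 : ∀ a b → a ≡ b [mod2^ 0 ]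
mod2^0 a b = mod (divides (a -ᶻ b) (trans (sym (ℤ.*-identityʳ (a -ᶻ b))) (cong ((a -ᶻ b) *ᶻ_) (sym (2^ᶻ-pos 0)))))

mod-weaken : ∀ {d e a b} → d ≤ e → a ≡ b [mod2^ e ] → a ≡ b [mod2^ d ]
mod-weaken d≤e (mod p) = mod (∣-trans (2^ᶻ-mono-∣ d≤e) p)

mod-cast : ∀ {d e a b} → d ≡ e → a ≡ b [mod2^ d ] → a ≡ b [mod2^ e ]
mod-cast refl a≡b = a≡b

mod2^-setoid : ℕ → Setoid _ _
mod2^-setoid e = record { isEquivalence = mod-isEquivalence {e} }

module ≡-mod-Reasoning (e : ℕ) = SetoidReasoning (mod2^-setoid e)

+-≡0-mod : ∀ {e a x} → x ≡ + 0 [mod2^ e ] → a +ᶻ x ≡ a [mod2^ e ]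
+-≡0-mod {a = a} x≡0 = mod-trans (+-congˡ-mod a x≡0) (mod-reflexive (ℤ.+-identityʳ a))

^-≡1-mod : ∀ {e B} n → B ≡ + 1 [mod2^ e ] → B ^ᶻ n ≡ + 1 [mod2^ e ]
^-≡1-mod n B≡1 = mod-trans (^-cong-mod n B≡1) (mod-reflexive (ℤ.^-zeroˡ n))

-- Odd numbers and division by them modulo 2^b

Odd : ℤ → Set
Odd z = Σ ℤ λ r → z ≡ + 1 +ᶻ r *ᶻ + 2

Even : ℤ → Set
Even z = Σ ℤ λ r → z ≡ r *ᶻ + 2

even⊎odd : ∀ z → Even z ⊎ Odd z
even⊎odd z with z %ℕ 2 | a≡a%ℕn+[a/ℕn]*n z 2 | n%ℕd<d z 2
... | 0 | eq | _ = inj₁ (z /ℕ 2 , trans eq (ℤ.+-identityˡ _))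
... | 1 | eq | _ = inj₂ (z /ℕ 2 , eq)
... | suc (suc _) | _ | s≤s (s≤s ())

odd-* : ∀ {a b} → Odd a → Odd b → Odd (a *ᶻ b)
odd-* (r , refl) (s , refl) = r +ᶻ s +ᶻ + 2 *ᶻ r *ᶻ s , lemma r s
  where lemma : ∀ r s → (+ 1 +ᶻ r *ᶻ + 2) *ᶻ (+ 1 +ᶻ s *ᶻ + 2) ≡ + 1 +ᶻ (r +ᶻ s +ᶻ + 2 *ᶻ r *ᶻ s) *ᶻ + 2
        lemma = solve-∀

odd-^ : ∀ {a} n → Odd a → Odd (a ^ᶻ n)
odd-^ zero    _ = + 0 , refl
odd-^ (suc n) o = odd-* o (odd-^ n o)

-- divOdd b a ω Δ is (Δ / 2^a)·ω⁻¹ modulo 2^b, computed one binary digit at a time.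
opaque
  divOdd : (b a : ℕ) (ω Δ : ℤ) → ℕ
  divOdd zero    a ω Δ = 0
  divOdd (suc b) a ω Δ with 2^ᶻ (a + suc b) ∣? Δ -ᶻ + divOdd b a ω Δ *ᶻ 2^ᶻ a *ᶻ ω
  ... | yes _ = divOdd b a ω Δ
  ... | no  _ = divOdd b a ω Δ + 2 ^ b

  divOdd<2^ : ∀ b a ω Δ → divOdd b a ω Δ < 2 ^ b
  divOdd<2^ zero    a ω Δ = s≤s z≤n
  divOdd<2^ (suc b) a ω Δ with 2^ᶻ (a + suc b) ∣? Δ -ᶻ + divOdd b a ω Δ *ᶻ 2^ᶻ a *ᶻ ω
  ... | yes _ = ℕ.<-≤-trans (divOdd<2^ b a ω Δ) (ℕ.m≤m+n (2 ^ b) _)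
  ... | no  _ = subst (divOdd b a ω Δ + 2 ^ b <_) (cong (λ z → 2 ^ b + z) (sym (ℕ.+-identityʳ (2 ^ b))))
                      (ℕ.+-monoˡ-< (2 ^ b) (divOdd<2^ b a ω Δ))

  divOdd-spec : ∀ b a {ω Δ} → Odd ω → 2^ᶻ a ∣ Δ → 2^ᶻ (a + b) ∣ Δ -ᶻ + divOdd b a ω Δ *ᶻ 2^ᶻ a *ᶻ ω
  divOdd-spec zero a {ω} {Δ} _ a∣Δ rewrite ℕ.+-identityʳ a = subst (2^ᶻ a ∣_) (lemma Δ (2^ᶻ a) ω) a∣Δ
    where lemma : ∀ Δ P ω → Δ ≡ Δ -ᶻ + 0 *ᶻ P *ᶻ ω
          lemma = solve-∀
  divOdd-spec (suc b) a {ω} {Δ} ω-odd a∣Δ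
    with 2^ᶻ (a + suc b) ∣? Δ -ᶻ + divOdd b a ω Δ *ᶻ 2^ᶻ a *ᶻ ω | divOdd-spec b a ω-odd a∣Δ
  ... | yes a+b+1∣ | _ = a+b+1∣
  ... | no ¬a+b+1∣ | divides q eq with even⊎odd q | ω-odd
  ...   | inj₁ (r , refl) | _ =
    ⊥-elim (¬a+b+1∣ (divides r (begin
      Δ -ᶻ + d *ᶻ A *ᶻ ω          ≡⟨ eq ⟩
      r *ᶻ + 2 *ᶻ 2^ᶻ (a + b)     ≡⟨ cong (r *ᶻ + 2 *ᶻ_) (2^ᶻ-+ a b) ⟩
      r *ᶻ + 2 *ᶻ (A *ᶻ B)        ≡⟨ lemma r A B ⟩
      r *ᶻ (A *ᶻ (+ 2 *ᶻ B))      ≡⟨ cong (r *ᶻ_) (2^ᶻ-+-suc a b) ⟨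
      r *ᶻ 2^ᶻ (a + suc b)        ∎)))
    where
    open ≡-Reasoning
    d : ℕ
    d = divOdd b a ω Δ
    A B : ℤ
    A = 2^ᶻ a
    B = 2^ᶻ b
    lemma : ∀ r A B → r *ᶻ + 2 *ᶻ (A *ᶻ B) ≡ r *ᶻ (A *ᶻ (+ 2 *ᶻ B))
    lemma = solve-∀
  ...   | inj₂ (r , refl) | s , refl = divides (r -ᶻ s) (begin
      Δ -ᶻ + (d + 2 ^ b) *ᶻ A *ᶻ ω        ≡⟨ cong (λ z → Δ -ᶻ z *ᶻ A *ᶻ ω) d+2^b≡ ⟩
      Δ -ᶻ (+ d +ᶻ B) *ᶻ A *ᶻ ω           ≡⟨ cong (λ z → z -ᶻ (+ d +ᶻ B) *ᶻ A *ᶻ ω) Δ≡ ⟩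
      + d *ᶻ A *ᶻ ω +ᶻ q *ᶻ (A *ᶻ B) -ᶻ (+ d +ᶻ B) *ᶻ A *ᶻ ω ≡⟨ lemma (+ d) r s A B ⟩
      (r -ᶻ s) *ᶻ (A *ᶻ (+ 2 *ᶻ B))      ≡⟨ cong ((r -ᶻ s) *ᶻ_) (2^ᶻ-+-suc a b) ⟨
      (r -ᶻ s) *ᶻ 2^ᶻ (a + suc b)        ∎)
    where
    open ≡-Reasoning
    d : ℕ
    d = divOdd b a ω Δ
    A B : ℤ
    A = 2^ᶻ a
    B = 2^ᶻ b
    d+2^b≡ : + (d + 2 ^ b) ≡ + d +ᶻ B
    d+2^b≡ = trans (ℤ.pos-+ d (2 ^ b)) (cong (+ d +ᶻ_) (sym (2^ᶻ-pos b)))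
    Δ≡ : Δ ≡ + d *ᶻ A *ᶻ ω +ᶻ q *ᶻ (A *ᶻ B)
    Δ≡ = trans (a-b≡c⇒a≡b+c eq) (cong (λ z → + d *ᶻ A *ᶻ ω +ᶻ q *ᶻ z) (2^ᶻ-+ a b))
    lemma : ∀ d r s A B → let ω = + 1 +ᶻ s *ᶻ + 2 in
      d *ᶻ A *ᶻ ω +ᶻ (+ 1 +ᶻ r *ᶻ + 2) *ᶻ (A *ᶻ B) -ᶻ (d +ᶻ B) *ᶻ A *ᶻ ω ≡ (r -ᶻ s) *ᶻ (A *ᶻ (+ 2 *ᶻ B))
    lemma = solve-∀

divOdd-lifts : ∀ b a {ω A B} → Odd ω → A ≡ B [mod2^ a ] →
  A ≡ B +ᶻ + divOdd b a ω (A -ᶻ B) *ᶻ 2^ᶻ a *ᶻ ω [mod2^ (a + b) ]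
divOdd-lifts b a {ω} {A} {B} ω-odd (mod a∣A-B) =
  mod (subst (2^ᶻ (a + b) ∣_) (lemma A B (+ divOdd b a ω (A -ᶻ B) *ᶻ 2^ᶻ a *ᶻ ω))
             (divOdd-spec b a ω-odd a∣A-B))
  where lemma : ∀ A B D → A -ᶻ B -ᶻ D ≡ A -ᶻ (B +ᶻ D)
        lemma = solve-∀

-- Linear approximation of (B + h)^n

^-+-linear : ∀ {c s B h} → c ≤ s → B ≡ + 1 [mod2^ c ] → 2^ᶻ s ∣ h → ∀ n →
  (B +ᶻ h) ^ᶻ n ≡ B ^ᶻ n +ᶻ + n *ᶻ h [mod2^ (c + s) ]
^-+-linear {h = h} _ _ _ zero = mod-reflexive (lemma h)
  where lemma : ∀ h → + 1 ≡ + 1 +ᶻ + 0 *ᶻ h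
        lemma = solve-∀
^-+-linear {c} {s} {B} {h} c≤s B≡1 s∣h (suc n) = begin
  (B +ᶻ h) *ᶻ (B +ᶻ h) ^ᶻ n              ≈⟨ *-congˡ-mod (B +ᶻ h) (^-+-linear c≤s B≡1 s∣h n) ⟩
  (B +ᶻ h) *ᶻ (B ^ᶻ n +ᶻ + n *ᶻ h)       ≡⟨ expand B h (B ^ᶻ n) (+ n) ⟩
  B *ᶻ B ^ᶻ n +ᶻ + suc n *ᶻ h +ᶻ error  ≈⟨ +-≡0-mod (∣⇒≡0-mod error-small) ⟩
  B *ᶻ B ^ᶻ n +ᶻ + suc n *ᶻ h           ∎
  where
  open ≡-mod-Reasoning (c + s)
  error : ℤ
  error = (B ^ᶻ n -ᶻ + 1) *ᶻ h +ᶻ + n *ᶻ ((B -ᶻ + 1) *ᶻ h) +ᶻ + n *ᶻ (h *ᶻ h)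
  expand : ∀ B h Bⁿ n → (B +ᶻ h) *ᶻ (Bⁿ +ᶻ n *ᶻ h) ≡
    B *ᶻ Bⁿ +ᶻ (+ 1 +ᶻ n) *ᶻ h +ᶻ ((Bⁿ -ᶻ + 1) *ᶻ h +ᶻ n *ᶻ ((B -ᶻ + 1) *ᶻ h) +ᶻ n *ᶻ (h *ᶻ h))
  expand = solve-∀
  error-small : 2^ᶻ (c + s) ∣ error
  error-small = ∣m∣n⇒∣m+n (∣m∣n⇒∣m+n (∣-*-2^ᶻ (2^e∣a-b (^-≡1-mod n B≡1)) s∣h)
                                     (∣n⇒∣m*n (+ n) (∣-*-2^ᶻ (2^e∣a-b B≡1) s∣h)))
                          (∣n⇒∣m*n (+ n) (∣-trans (2^ᶻ-mono-∣ (ℕ.+-monoˡ-≤ s c≤s)) (∣-*-2^ᶻ s∣h s∣h)))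

^2-cong-mod : ∀ {t X Z} → X ≡ Z [mod2^ suc t ] → X *ᶻ X ≡ Z *ᶻ Z [mod2^ suc (suc t) ]
^2-cong-mod {t} {X} {Z} (mod t∣X-Z) =
  mod (subst (2^ᶻ suc (suc t) ∣_) (lemma X Z) (∣-*-2^ᶻ {1} 2∣X+Z t∣X-Z))
  where
  2∣X+Z : 2^ᶻ 1 ∣ (X -ᶻ Z) +ᶻ Z *ᶻ + 2
  2∣X+Z = ∣m∣n⇒∣m+n (∣-trans (2^ᶻ-mono-∣ (s≤s z≤n)) t∣X-Z) (∣n⇒∣m*n Z (∣-reflexive (2^ᶻ-pos 1)))
  lemma : ∀ X Z → ((X -ᶻ Z) +ᶻ Z *ᶻ + 2) *ᶻ (X -ᶻ Z) ≡ X *ᶻ X -ᶻ Z *ᶻ Z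
  lemma = solve-∀

-- Every doubling of the exponent gains one factor of 2, by ^2-cong-mod.
^-+-linear-2^ : ∀ {c s B h} → suc c ≤ s → B ≡ + 1 [mod2^ suc c ] → 2^ᶻ s ∣ h → ∀ a n →
  (B +ᶻ h) ^ᶻ (2 ^ a * n) ≡ B ^ᶻ (2 ^ a * n) +ᶻ + (2 ^ a * n) *ᶻ h [mod2^ (s + a + c) ]
^-+-linear-2^ {c} {s} c<s B≡1 s∣h zero n rewrite ℕ.+-identityʳ n =
  mod-weaken (m+k≡n⇒m≤n 1 (lemma s c)) (^-+-linear c<s B≡1 s∣h n)
  where lemma : ∀ s c → s + 0 + c + 1 ≡ suc c + s
        lemma = ℕ-Solver.solve-∀
^-+-linear-2^ {c} {suc s'} {B} {h} (s≤s c≤s') B≡1 s∣h (suc a) n = begin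
  (B +ᶻ h) ^ᶻ (2 ^ suc a * n)          ≡⟨ cong ((B +ᶻ h) ^ᶻ_) 2M≡M+M ⟩
  (B +ᶻ h) ^ᶻ (M + M)                  ≡⟨ ℤ.^-distribˡ-+-* (B +ᶻ h) M M ⟩
  X *ᶻ X                               ≈⟨ mod-cast modulus≡ (^2-cong-mod IH) ⟩
  Z *ᶻ Z                               ≡⟨ expand Y (+ M) h ⟩
  Y *ᶻ Y +ᶻ (+ M +ᶻ + M) *ᶻ h +ᶻ error  ≈⟨ +-≡0-mod (∣⇒≡0-mod error-small) ⟩
  Y *ᶻ Y +ᶻ (+ M +ᶻ + M) *ᶻ h          ≡⟨ cong₂ (λ p q → p +ᶻ q *ᶻ h) (ℤ.^-distribˡ-+-* B M M) (ℤ.pos-+ M M) ⟨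
  B ^ᶻ (M + M) +ᶻ + (M + M) *ᶻ h       ≡⟨ cong (λ k → B ^ᶻ k +ᶻ + k *ᶻ h) 2M≡M+M ⟨
  B ^ᶻ (2 ^ suc a * n) +ᶻ + (2 ^ suc a * n) *ᶻ h ∎
  where
  open ≡-mod-Reasoning (suc s' + suc a + c)
  M : ℕ
  M = 2 ^ a * n
  X Y Z error : ℤ
  X = (B +ᶻ h) ^ᶻ M
  Y = B ^ᶻ M
  Z = Y +ᶻ + M *ᶻ h
  error = (+ M +ᶻ + M) *ᶻ h *ᶻ (Y -ᶻ + 1) +ᶻ (+ M *ᶻ h) *ᶻ (+ M *ᶻ h)
  IH : X ≡ Z [mod2^ (suc s' + a + c) ]
  IH = ^-+-linear-2^ (s≤s c≤s') B≡1 s∣h a n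
  2M≡M+M : 2 ^ suc a * n ≡ M + M
  2M≡M+M = trans (ℕ.*-assoc 2 (2 ^ a) n) (cong (λ k → M + k) (ℕ.+-identityʳ M))
  modulus≡ : suc (suc (s' + a + c)) ≡ suc s' + suc a + c
  modulus≡ = cong (λ k → suc (k + c)) (sym (ℕ.+-suc s' a))
  expand : ∀ Y M h → (Y +ᶻ M *ᶻ h) *ᶻ (Y +ᶻ M *ᶻ h) ≡
    Y *ᶻ Y +ᶻ (M +ᶻ M) *ᶻ h +ᶻ ((M +ᶻ M) *ᶻ h *ᶻ (Y -ᶻ + 1) +ᶻ (M *ᶻ h) *ᶻ (M *ᶻ h))
  expand = solve-∀
  2M∣ : 2^ᶻ suc a ∣ + M +ᶻ + M
  2M∣ = subst (2^ᶻ suc a ∣_) (trans (cong +_ 2M≡M+M) (ℤ.pos-+ M M)) (2^ᶻ∣2^* (suc a) n)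
  M∣ : 2^ᶻ a ∣ + M
  M∣ = 2^ᶻ∣2^* a n
  first-small : suc s' + suc a + c ≤ suc a + suc s' + suc c
  first-small = m+k≡n⇒m≤n 1 (lemma s' a c)
    where lemma : ∀ s a c → suc s + suc a + c + 1 ≡ suc a + suc s + suc c
          lemma = ℕ-Solver.solve-∀
  second-small : suc s' + suc a + c ≤ (a + suc s') + (a + suc s')
  second-small with ℕ.m≤n⇒∃[o]m+o≡n c≤s'
  ... | k , refl = m+k≡n⇒m≤n (a + k) (lemma c k a)
    where lemma : ∀ c k a → suc (c + k) + suc a + c + (a + k) ≡ (a + suc (c + k)) + (a + suc (c + k))
          lemma = ℕ-Solver.solve-∀
  error-small : 2^ᶻ (suc s' + suc a + c) ∣ error
  error-small = ∣m∣n⇒∣m+n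
    (∣-trans (2^ᶻ-mono-∣ first-small) (∣-*-2^ᶻ (∣-*-2^ᶻ 2M∣ s∣h) (2^e∣a-b (^-≡1-mod M B≡1))))
    (∣-trans (2^ᶻ-mono-∣ second-small) (∣-*-2^ᶻ (∣-*-2^ᶻ M∣ s∣h) (∣-*-2^ᶻ M∣ s∣h)))

when : Bool → ℤ → ℤ
when b z = if b then z else + 0

sumᶻ : ℕ → (ℕ → ℤ) → ℤ
sumᶻ zero    f = + 0
sumᶻ (suc n) f = sumᶻ n f +ᶻ f n

sumᶻ-cong : ∀ n {f g} → (∀ i → i < n → f i ≡ g i) → sumᶻ n f ≡ sumᶻ n g
sumᶻ-cong zero    _   = refl
sumᶻ-cong (suc n) f≡g = cong₂ _+ᶻ_ (sumᶻ-cong n (λ i i<n → f≡g i (ℕ.m<n⇒m<1+n i<n))) (f≡g n (ℕ.n<1+n n))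

sumᶻ-cong-mod : ∀ {e} n {f g} → (∀ i → i < n → f i ≡ g i [mod2^ e ]) → sumᶻ n f ≡ sumᶻ n g [mod2^ e ]
sumᶻ-cong-mod zero    _   = mod-refl
sumᶻ-cong-mod (suc n) f≡g = +-cong-mod (sumᶻ-cong-mod n (λ i i<n → f≡g i (ℕ.m<n⇒m<1+n i<n))) (f≡g n (ℕ.n<1+n n))

sumᶻ-+ : ∀ n f g → sumᶻ n (λ i → f i +ᶻ g i) ≡ sumᶻ n f +ᶻ sumᶻ n g
sumᶻ-+ zero    f g = refl
sumᶻ-+ (suc n) f g = trans (cong (_+ᶻ (f n +ᶻ g n)) (sumᶻ-+ n f g)) (lemma (sumᶻ n f) (sumᶻ n g) (f n) (g n))
  where lemma : ∀ a b c d → a +ᶻ b +ᶻ (c +ᶻ d) ≡ a +ᶻ c +ᶻ (b +ᶻ d)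
        lemma = solve-∀

*-distribˡ-sumᶻ : ∀ a n f → a *ᶻ sumᶻ n f ≡ sumᶻ n (λ i → a *ᶻ f i)
*-distribˡ-sumᶻ a zero    f = ℤ.*-zeroʳ a
*-distribˡ-sumᶻ a (suc n) f = trans (ℤ.*-distribˡ-+ a (sumᶻ n f) (f n)) (cong (_+ᶻ a *ᶻ f n) (*-distribˡ-sumᶻ a n f))

sumᶻ-const : ∀ n z → sumᶻ n (λ _ → z) ≡ + n *ᶻ z
sumᶻ-const zero    z = sym (ℤ.*-zeroˡ z)
sumᶻ-const (suc n) z = trans (cong (_+ᶻ z) (sumᶻ-const n z)) (lemma (+ n) z)
  where lemma : ∀ n z → n *ᶻ z +ᶻ z ≡ (+ 1 +ᶻ n) *ᶻ z
        lemma = solve-∀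

sumᶻ-indicator : ∀ n d z → d ≤ n → sumᶻ n (λ i → when (does (i <? d)) z) ≡ + d *ᶻ z
sumᶻ-indicator zero    .zero z z≤n = sym (ℤ.*-zeroˡ z)
sumᶻ-indicator (suc n) d     z d≤1+n with ℕ.m≤n⇒m<n∨m≡n d≤1+n
... | inj₁ d<1+n rewrite dec-false (n <? d) (ℕ.≤⇒≯ (ℕ.≤-pred d<1+n)) =
  trans (ℤ.+-identityʳ _) (sumᶻ-indicator n d z (ℕ.≤-pred d<1+n))
... | inj₂ refl rewrite dec-true (n <? suc n) (ℕ.n<1+n n) = begin
  sumᶻ n (λ i → when (does (i <? suc n)) z) +ᶻ z  ≡⟨ cong (_+ᶻ z) (sumᶻ-cong n all-below) ⟩
  sumᶻ n (λ i → when (does (i <? n)) z) +ᶻ z      ≡⟨ cong (_+ᶻ z) (sumᶻ-indicator n n z ℕ.≤-refl) ⟩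
  + n *ᶻ z +ᶻ z                                  ≡⟨ lemma (+ n) z ⟩
  + suc n *ᶻ z                                   ∎
  where
  open ≡-Reasoning
  all-below : ∀ i → i < n → when (does (i <? suc n)) z ≡ when (does (i <? n)) z
  all-below i i<n rewrite dec-true (i <? suc n) (ℕ.m<n⇒m<1+n i<n) | dec-true (i <? n) i<n = refl
  lemma : ∀ n z → n *ᶻ z +ᶻ z ≡ (+ 1 +ᶻ n) *ᶻ z
  lemma = solve-∀

sumᶻ-single : ∀ n f → (∀ t → f (suc t) ≡ + 0) → sumᶻ (suc n) f ≡ f 0
sumᶻ-single zero    f _       = ℤ.+-identityˡ (f 0)
sumᶻ-single (suc n) f f[1+t]≡0 = trans (cong₂ _+ᶻ_ (sumᶻ-single n f f[1+t]≡0) (f[1+t]≡0 n)) (ℤ.+-identityʳ (f 0))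

sumBelow-pos : ∀ n f → + sumBelow n f ≡ sumᶻ n (λ i → + f i)
sumBelow-pos zero    f = refl
sumBelow-pos (suc n) f = trans (ℤ.pos-+ (sumBelow n f) (f n)) (cong (_+ᶻ + f n) (sumBelow-pos n f))

sumBelow-*-if : ∀ n a (b : ℕ → Bool) (f : ℕ → ℕ) →
  sumBelow n (λ t → if b t then a * f t else 0) ≡ a * sumBelow n (λ t → if b t then f t else 0)
sumBelow-*-if zero    a b f = sym (ℕ.*-zeroʳ a)
sumBelow-*-if (suc n) a b f =
  trans (cong₂ _+_ (sumBelow-*-if n a b f) (lemma (b n)))
        (sym (ℕ.*-distribˡ-+ a (sumBelow n (λ t → if b t then f t else 0)) (if b n then f n else 0)))
  where lemma : ∀ bn → (if bn then a * f n else 0) ≡ a * (if bn then f n else 0)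
        lemma true  = refl
        lemma false = sym (ℕ.*-zeroʳ a)

sumFin-toℕ : ∀ k f → sumFin k (λ i → f (toℕ i)) ≡ sumBelow k f
sumFin-toℕ zero    f = refl
sumFin-toℕ (suc k) f = trans (cong (_+_ (f 0)) (sumFin-toℕ k (λ i → f (suc i)))) (sym (sumBelow-suc k f))
  where
  sumBelow-suc : ∀ n f → sumBelow (suc n) f ≡ f 0 + sumBelow n (λ i → f (suc i))
  sumBelow-suc zero    f = ℕ.+-comm 0 (f 0)
  sumBelow-suc (suc n) f = trans (cong (_+ f (suc n)) (sumBelow-suc n f)) (ℕ.+-assoc (f 0) _ _)

sumFin-cong : ∀ k {f g} → (∀ i → f i ≡ g i) → sumFin k f ≡ sumFin k g
sumFin-cong zero    _   = refl
sumFin-cong (suc k) f≡g = cong₂ _+_ (f≡g Fin.zero) (sumFin-cong k (λ i → f≡g (Fin.suc i)))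

sumFin-++ : ∀ k l f → sumFin (k + l) f ≡ sumFin k (λ i → f (i ↑ˡ l)) + sumFin l (λ i → f (k ↑ʳ i))
sumFin-++ zero    l f = refl
sumFin-++ (suc k) l f = trans (cong (_+_ (f Fin.zero)) (sumFin-++ k l (λ i → f (Fin.suc i)))) (sym (ℕ.+-assoc (f Fin.zero) _ _))

-- Residues of 2-adic integers

mod2^-≡-mod : ∀ N a → + (a mod2^ N) ≡ + a [mod2^ N ]
mod2^-≡-mod N a = mod (divides (- + (a / 2 ^ N)) (begin
  + (a % 2 ^ N) -ᶻ + a                                ≡⟨ cong (λ z → + (a % 2 ^ N) -ᶻ z) a≡ ⟩
  + (a % 2 ^ N) -ᶻ (+ (a % 2 ^ N) +ᶻ + (a / 2 ^ N) *ᶻ 2^ᶻ N) ≡⟨ lemma (+ (a % 2 ^ N)) (+ (a / 2 ^ N)) (2^ᶻ N) ⟩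
  - + (a / 2 ^ N) *ᶻ 2^ᶻ N                            ∎))
  where
  open ≡-Reasoning
  instance _ = ℕ.m^n≢0 2 N
  a≡ : + a ≡ + (a % 2 ^ N) +ᶻ + (a / 2 ^ N) *ᶻ 2^ᶻ N
  a≡ = begin
    + a                                         ≡⟨ cong +_ (m≡m%n+[m/n]*n a (2 ^ N)) ⟩
    + (a % 2 ^ N + a / 2 ^ N * 2 ^ N)             ≡⟨ ℤ.pos-+ (a % 2 ^ N) _ ⟩
    + (a % 2 ^ N) +ᶻ + (a / 2 ^ N * 2 ^ N)        ≡⟨ cong (+ (a % 2 ^ N) +ᶻ_) (ℤ.pos-* (a / 2 ^ N) (2 ^ N)) ⟩
    + (a % 2 ^ N) +ᶻ + (a / 2 ^ N) *ᶻ + 2 ^ N     ≡⟨ cong (λ P → + (a % 2 ^ N) +ᶻ + (a / 2 ^ N) *ᶻ P) (2^ᶻ-pos N) ⟨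
    + (a % 2 ^ N) +ᶻ + (a / 2 ^ N) *ᶻ 2^ᶻ N       ∎
  lemma : ∀ r q P → r -ᶻ (r +ᶻ q *ᶻ P) ≡ - q *ᶻ P
  lemma = solve-∀

private
  quotient⇒mod2^-≡ : ∀ {N} a b k → + a -ᶻ + b ≡ + k *ᶻ 2^ᶻ N → a mod2^ N ≡ b mod2^ N
  quotient⇒mod2^-≡ {N} a b k eq = trans (cong (_mod2^ N) a≡b+kP) ([m+kn]%n≡m%n b k (2 ^ N))
    where
    instance _ = ℕ.m^n≢0 2 N
    a≡b+kP : a ≡ b + k * 2 ^ N
    a≡b+kP = ℤ.+-injective (begin
      + a                       ≡⟨ a-b≡c⇒a≡b+c {b = + b} eq ⟩
      + b +ᶻ + k *ᶻ 2^ᶻ N       ≡⟨ cong (λ P → + b +ᶻ + k *ᶻ P) (2^ᶻ-pos N) ⟩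
      + b +ᶻ + k *ᶻ + 2 ^ N     ≡⟨ cong (+ b +ᶻ_) (ℤ.pos-* k (2 ^ N)) ⟨
      + b +ᶻ + (k * 2 ^ N)      ≡⟨ ℤ.pos-+ b (k * 2 ^ N) ⟨
      + (b + k * 2 ^ N)         ∎)
      where open ≡-Reasoning

≡-mod⇒mod2^-≡ : ∀ {N} a b → + a ≡ + b [mod2^ N ] → a mod2^ N ≡ b mod2^ N
≡-mod⇒mod2^-≡ a b (mod (divides (+ k) eq))    = quotient⇒mod2^-≡ a b k eq
≡-mod⇒mod2^-≡ {N} a b (mod (divides -[1+ k ] eq)) =
  sym (quotient⇒mod2^-≡ b a (suc k) (trans (lemma (+ a) (+ b)) (trans (cong -_ eq) (ℤ.neg-distribˡ-* -[1+ k ] (2^ᶻ N)))))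
  where lemma : ∀ a b → b -ᶻ a ≡ - (a -ᶻ b)
        lemma = solve-∀

res-mod2^-+ : (y : ℤ₂) → ∀ N k → res y (N + k) mod2^ N ≡ res y N
res-mod2^-+ y N zero rewrite ℕ.+-identityʳ N = m<n⇒m%n≡m {{ℕ.m^n≢0 2 N}} (res-< y N)
res-mod2^-+ y N (suc k) rewrite ℕ.+-suc N k = begin
  res y (suc (N + k)) mod2^ N                 ≡⟨ m∣n⇒o%n%m≡o%m (2 ^ N) (2 ^ (N + k)) _
                                                    {{ℕ.m^n≢0 2 N}} {{ℕ.m^n≢0 2 (N + k)}} 2^N∣2^[N+k] ⟨
  (res y (suc (N + k)) mod2^ (N + k)) mod2^ N ≡⟨ cong (_mod2^ N) (res-coh y (N + k)) ⟩
  res y (N + k) mod2^ N                       ≡⟨ res-mod2^-+ y N k ⟩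
  res y N                                     ∎
  where
  open ≡-Reasoning
  2^N∣2^[N+k] : 2 ^ N ℕᵈ.∣ 2 ^ (N + k)
  2^N∣2^[N+k] = ℕᵈ.divides (2 ^ k) (trans (ℕ.^-distribˡ-+-* 2 N k) (ℕ.*-comm (2 ^ N) (2 ^ k)))

res-mod2^ : (y : ℤ₂) → ∀ {N L} → N ≤ L → res y L mod2^ N ≡ res y N
res-mod2^ y {N} N≤L with ℕ.m≤n⇒∃[o]m+o≡n N≤L
... | k , refl = res-mod2^-+ y N k

_/2^_ : ℕ → ℕ → ℕ
a /2^ e = _/_ a (2 ^ e) {{ℕ.m^n≢0 2 e}}

res-val : ∀ {y v} → HasVal₂ y v → res y (suc v) ≡ 2 ^ v
res-val {y} {v} (res-v≡0 , res-v+1≢0) = begin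
  r                         ≡⟨ m≡m%n+[m/n]*n r (2 ^ v) ⟩
  r % 2 ^ v + r / 2 ^ v * 2 ^ v ≡⟨ cong₂ (λ a b → a + b * 2 ^ v) r%2^v≡0 r/2^v≡1 ⟩
  0 + 1 * 2 ^ v             ≡⟨ ℕ.+-identityʳ (2 ^ v) ⟩
  2 ^ v                     ∎
  where
  open ≡-Reasoning
  instance _ = ℕ.m^n≢0 2 v
  r = res y (suc v)
  r%2^v≡0 : r % 2 ^ v ≡ 0
  r%2^v≡0 = trans (res-coh y v) res-v≡0
  r/2^v≡1 : r / 2 ^ v ≡ 1
  r/2^v≡1 with r / 2 ^ v in eq | m<n*o⇒m/o<n {r} {2} {2 ^ v} (res-< y (suc v))
  ... | 0 | _ = ⊥-elim (res-v+1≢0 (trans (m≡m%n+[m/n]*n r (2 ^ v)) (cong₂ (λ a b → a + b * 2 ^ v) r%2^v≡0 eq)))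
  ... | 1 | _ = refl
  ... | suc (suc _) | s≤s (s≤s ())

res-factor : ∀ {y v} → HasVal₂ y v → ∀ {L} → suc v ≤ L →
  res y L ≡ 2 ^ v * (1 + 2 * (res y L /2^ suc v))
res-factor {y} {v} y-val {L} v<L = begin
  res y L                              ≡⟨ m≡m%n+[m/n]*n (res y L) (2 ^ suc v) ⟩
  res y L mod2^ suc v + q * 2 ^ suc v   ≡⟨ cong (_+ q * 2 ^ suc v) (trans (res-mod2^ y v<L) (res-val {y} {v} y-val)) ⟩
  2 ^ v + q * (2 * 2 ^ v)              ≡⟨ lemma (2 ^ v) q ⟩
  2 ^ v * (1 + 2 * q)                  ∎
  where
  open ≡-Reasoning
  instance _ = ℕ.m^n≢0 2 (suc v)
  q = res y L / 2 ^ suc v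
  lemma : ∀ P q → P + q * (2 * P) ≡ P * (1 + 2 * q)
  lemma = ℕ-Solver.solve-∀

Cval-≡-mod : ∀ γ b N →
  + Cval γ b N ≡ (+ res γ N -ᶻ + 1) *ᶻ sumᶻ N (λ t → when (b t) ((+ res γ N) ^ᶻ t)) [mod2^ N ]
Cval-≡-mod γ b N = begin
  + Cval γ b N                                   ≈⟨ mod2^-≡-mod N _ ⟩
  + sumBelow N (λ t → if b t then U * g ^ t else 0) ≡⟨ cong +_ (sumBelow-*-if N U b (g ^_)) ⟩
  + (U * sumBelow N (λ t → if b t then g ^ t else 0)) ≡⟨ ℤ.pos-* U _ ⟩
  + U *ᶻ + sumBelow N (λ t → if b t then g ^ t else 0) ≡⟨ cong (+ U *ᶻ_) digits-pos ⟩
  + U *ᶻ digitSum                                ≈⟨ *-cong-mod U≡γ-1 mod-refl ⟩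
  (+ g -ᶻ + 1) *ᶻ digitSum                        ∎
  where
  open ≡-mod-Reasoning N
  g U : ℕ
  g = res γ N
  U = g + (2 ^ N ∸ 1)
  digitSum : ℤ
  digitSum = sumᶻ N (λ t → when (b t) ((+ g) ^ᶻ t))
  digit-pos : ∀ bt t → + (if bt then g ^ t else 0) ≡ when bt ((+ g) ^ᶻ t)
  digit-pos true  t = pos-^ g t
  digit-pos false t = refl
  digits-pos : + sumBelow N (λ t → if b t then g ^ t else 0) ≡ digitSum
  digits-pos = trans (sumBelow-pos N _) (sumᶻ-cong N (λ t _ → digit-pos (b t) t))
  U≡γ-1 : + U ≡ + g -ᶻ + 1 [mod2^ N ]
  U≡γ-1 = begin
    + U                            ≡⟨ ℤ.pos-+ g (2 ^ N ∸ 1) ⟩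
    + g +ᶻ + (2 ^ N ∸ 1)           ≡⟨ cong (+ g +ᶻ_) (pos-2^∸1 N) ⟩
    + g +ᶻ (2^ᶻ N -ᶻ + 1)          ≈⟨ +-congˡ-mod (+ g) (+-cong-mod (∣⇒≡0-mod ∣-refl) mod-refl) ⟩
    + g +ᶻ (+ 0 -ᶻ + 1)            ≡⟨ cong (+ g +ᶻ_) (ℤ.+-identityˡ (- + 1)) ⟩
    + g -ᶻ + 1                     ∎

Coherent : (ℕ → ℤ) → Set
Coherent f = ∀ {N L} → N ≤ L → f L ≡ f N [mod2^ N ]

res-coherent : (y : ℤ₂) → Coherent (λ L → + res y L)
res-coherent y {N} {L} N≤L = mod-trans (mod-sym (mod2^-≡-mod N (res y L))) (mod-reflexive (cong +_ (res-mod2^ y N≤L)))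

const-coherent : ∀ a → Coherent (λ _ → a)
const-coherent a _ = mod-refl

+-coherent : ∀ {f g} → Coherent f → Coherent g → Coherent (λ L → f L +ᶻ g L)
+-coherent f-coh g-coh N≤L = +-cong-mod (f-coh N≤L) (g-coh N≤L)

*-coherent : ∀ {f g} → Coherent f → Coherent g → Coherent (λ L → f L *ᶻ g L)
*-coherent f-coh g-coh N≤L = *-cong-mod (f-coh N≤L) (g-coh N≤L)

^-coherent : ∀ {f} n → Coherent f → Coherent (λ L → f L ^ᶻ n)
^-coherent n f-coh N≤L = ^-cong-mod n (f-coh N≤L)

when-coherent : ∀ {f} b → Coherent f → Coherent (λ L → when b (f L))
when-coherent true  f-coh = f-coh
when-coherent false _     = const-coherent (+ 0)

sumᶻ-coherent : ∀ n {F : ℕ → ℕ → ℤ} → (∀ i → Coherent (λ L → F L i)) → Coherent (λ L → sumᶻ n (F L))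
sumᶻ-coherent n F-coh N≤L = sumᶻ-cong-mod n (λ i _ → F-coh i N≤L)

module Construction (γ : ℤ₂) (v' : ℕ) (γ-val : HasVal₂ γ (suc v')) (m' w : ℕ) (m-val : NatVal₂ (suc m') w) where

  v m : ℕ
  v = suc v'
  m = suc m'

  γ̃ γ̃-1 oddPart : ℕ → ℤ
  γ̃ L = + res γ L
  γ̃-1 L = γ̃ L -ᶻ + 1
  oddPart L = + (1 + 2 * (res γ L /2^ suc v))

  γ̃-factor : ∀ {L} → suc v ≤ L → γ̃ L ≡ 2^ᶻ v *ᶻ oddPart L
  γ̃-factor {L} v<L = trans (cong +_ (res-factor {γ} {v} γ-val v<L))
                           (trans (ℤ.pos-* (2 ^ v) _) (cong (_*ᶻ oddPart L) (sym (2^ᶻ-pos v))))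

  γ̃^-factor : ∀ {L} → suc v ≤ L → ∀ p → γ̃ L ^ᶻ p ≡ 2^ᶻ (p * v) *ᶻ oddPart L ^ᶻ p
  γ̃^-factor {L} v<L p = begin
    γ̃ L ^ᶻ p                        ≡⟨ cong (_^ᶻ p) (γ̃-factor v<L) ⟩
    (2^ᶻ v *ᶻ oddPart L) ^ᶻ p       ≡⟨ ^-distribʳ-* (2^ᶻ v) (oddPart L) p ⟩
    2^ᶻ v ^ᶻ p *ᶻ oddPart L ^ᶻ p    ≡⟨ cong (_*ᶻ oddPart L ^ᶻ p) (2^ᶻ-* p v) ⟨
    2^ᶻ (p * v) *ᶻ oddPart L ^ᶻ p   ∎
    where open ≡-Reasoning

  γ̃^-divisible : ∀ {L} → suc v ≤ L → ∀ p → 2^ᶻ (p * v) ∣ γ̃ L ^ᶻ p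
  γ̃^-divisible {L} v<L p = divides (oddPart L ^ᶻ p) (trans (γ̃^-factor v<L p) (ℤ.*-comm (2^ᶻ (p * v)) (oddPart L ^ᶻ p)))

  oddPart-odd : ∀ L → Odd (oddPart L)
  oddPart-odd L = + q , trans (ℤ.pos-+ 1 (2 * q)) (cong (+ 1 +ᶻ_) (trans (ℤ.pos-* 2 q) (ℤ.*-comm (+ 2) (+ q))))
    where q = res γ L /2^ suc v

  γ̃-1-odd : ∀ {L} → suc v ≤ L → Odd (γ̃-1 L)
  γ̃-1-odd {L} v<L = 2^ᶻ v' *ᶻ oddPart L -ᶻ + 1 , (begin
    γ̃ L -ᶻ + 1                                   ≡⟨ cong (_-ᶻ + 1) (γ̃-factor v<L) ⟩
    2^ᶻ v *ᶻ oddPart L -ᶻ + 1                    ≡⟨ cong (λ P → P *ᶻ oddPart L -ᶻ + 1) (2^ᶻ-suc v') ⟩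
    + 2 *ᶻ 2^ᶻ v' *ᶻ oddPart L -ᶻ + 1            ≡⟨ lemma (2^ᶻ v') (oddPart L) ⟩
    + 1 +ᶻ (2^ᶻ v' *ᶻ oddPart L -ᶻ + 1) *ᶻ + 2   ∎)
    where
    open ≡-Reasoning
    lemma : ∀ P g → + 2 *ᶻ P *ᶻ g -ᶻ + 1 ≡ + 1 +ᶻ (P *ᶻ g -ᶻ + 1) *ᶻ + 2
    lemma = solve-∀

  γ̃-coherent : Coherent γ̃
  γ̃-coherent = res-coherent γ

  γ̃-1-coherent : Coherent γ̃-1
  γ̃-1-coherent = +-coherent γ̃-coherent (const-coherent (- + 1))

  γ̃^-vanishes : ∀ {N t} → N ≤ t → γ̃ N ^ᶻ t ≡ + 0 [mod2^ N ]
  γ̃^-vanishes {N} {t} N≤t = mod-trans (mod-sym (^-coherent t γ̃-coherent (ℕ.m≤m+n N (suc v))))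
    (∣⇒≡0-mod (∣-trans (2^ᶻ-mono-∣ N≤t*v) (γ̃^-divisible (ℕ.m≤n+m (suc v) N) t)))
    where
    N≤t*v : N ≤ t * v
    N≤t*v = ℕ.≤-trans N≤t (ℕ.m≤m*n t v)

  o : ℕ
  o = ℕᵈ._∣_.quotient (proj₁ m-val)

  m≡o*2^w : m ≡ o * 2 ^ w
  m≡o*2^w = ℕᵈ._∣_.equality (proj₁ m-val)

  o-odd : Odd (+ o)
  o-odd with o % 2 | m≡m%n+[m/n]*n o 2 | m%n<n o 2
  ... | 0 | o≡ | _ =
    ⊥-elim (proj₂ m-val (ℕᵈ.divides (o / 2) (trans m≡o*2^w (trans (cong (_* 2 ^ w) o≡) (lemma (o / 2) (2 ^ w))))))
    where lemma : ∀ q P → (0 + q * 2) * P ≡ q * (2 * P)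
          lemma = ℕ-Solver.solve-∀
  ... | 1 | o≡ | _ = + (o / 2) , trans (cong +_ o≡) (trans (ℤ.pos-+ 1 (o / 2 * 2)) (cong (+ 1 +ᶻ_) (ℤ.pos-* (o / 2) 2)))
  ... | suc (suc _) | _ | s≤s (s≤s ())

  K : ℕ
  K = 2 ^ v ∸ 1

  -- the 2-adic valuation of m·γ^p
  level : ℕ → ℕ
  level p = w + p * v

  -- The i-th principal summand is (γ − 1)·Σ_{t : i < positions D t} γ^t.
  positions : (ℕ → ℕ) → ℕ → ℕ
  positions D zero          = K
  positions D (suc zero)    = 0
  positions D (suc (suc n)) = D n

  principalDigits : (ℕ → ℕ) → ℕ → ℕ → Bool
  principalDigits D i t = does (i <? positions D t)

  cofactor : ℕ → (ℕ → ℕ) → ℕ → ℕ → ℤ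
  cofactor L D i p = sumᶻ p (λ t → when (principalDigits D i t) (γ̃ L ^ᶻ t))

  -- The sum of the m-th powers of the summands, modulo 2^L, when c constant summands are
  -- γ − 1 and the principal ones are truncated below γ^p.
  powerSum : ℕ → ℕ → (ℕ → ℕ) → ℕ → ℤ
  powerSum c L D p = γ̃-1 L ^ᶻ m *ᶻ (+ c +ᶻ sumᶻ K (λ i → cofactor L D i p ^ᶻ m))

  cofactor-coherent : ∀ D i p → Coherent (λ L → cofactor L D i p)
  cofactor-coherent D i p = sumᶻ-coherent p (λ t → when-coherent (principalDigits D i t) (^-coherent t γ̃-coherent))

  powerSum-coherent : ∀ c D p → Coherent (λ L → powerSum c L D p)
  powerSum-coherent c D p = *-coherent (^-coherent m γ̃-1-coherent)
    (+-coherent (const-coherent (+ c)) (sumᶻ-coherent K (λ i → ^-coherent m (cofactor-coherent D i p))))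

  powerSum-ext : ∀ c L {D D'} j → (∀ n → n < j → D n ≡ D' n) → powerSum c L D (2 + j) ≡ powerSum c L D' (2 + j)
  powerSum-ext c L {D} {D'} j D≡D' =
    cong (λ S → γ̃-1 L ^ᶻ m *ᶻ (+ c +ᶻ S)) (sumᶻ-cong K (λ i _ → cong (_^ᶻ m) (sumᶻ-cong (2 + j) (λ t t<2+j →
      cong (λ d → when (does (i <? d)) (γ̃ L ^ᶻ t)) (positions-ext t t<2+j)))))
    where
    positions-ext : ∀ t → t < 2 + j → positions D t ≡ positions D' t
    positions-ext zero          _             = refl
    positions-ext (suc zero)    _             = refl
    positions-ext (suc (suc n)) (s≤s (s≤s n<j)) = D≡D' n n<j

  cofactor-two : ∀ L D {i} → i < K → cofactor L D i 2 ≡ + 1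
  cofactor-two L D {i} i<K rewrite dec-true (i <? K) i<K = ℤ.+-identityʳ (+ 0 +ᶻ + 1)

  cofactor≡1 : ∀ {L} → suc v ≤ L → ∀ D {i} → i < K → ∀ j → cofactor L D i (2 + j) ≡ + 1 [mod2^ (v + v) ]
  cofactor≡1 {L} v<L D i<K zero = mod-reflexive (cofactor-two L D i<K)
  cofactor≡1 {L} v<L D {i} i<K (suc j) =
    mod-trans (+-≡0-mod (new-term (principalDigits D i (2 + j)))) (cofactor≡1 v<L D i<K j)
    where
    new-term : ∀ b → when b (γ̃ L ^ᶻ (2 + j)) ≡ + 0 [mod2^ (v + v) ]
    new-term true  = ∣⇒≡0-mod (∣-trans (2^ᶻ-mono-∣ (ℕ.+-monoʳ-≤ v (ℕ.m≤m+n v (j * v)))) (γ̃^-divisible v<L (2 + j)))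
    new-term false = mod-refl

  cofactor-truncate : ∀ D i N k → cofactor N D i (k + N) ≡ cofactor N D i N [mod2^ N ]
  cofactor-truncate D i N zero    = mod-refl
  cofactor-truncate D i N (suc k) =
    mod-trans (+-≡0-mod (new-term (principalDigits D i (k + N)))) (cofactor-truncate D i N k)
    where
    new-term : ∀ b → when b (γ̃ N ^ᶻ (k + N)) ≡ + 0 [mod2^ N ]
    new-term true  = γ̃^-vanishes (ℕ.m≤n+m N k)
    new-term false = mod-refl

  level-≥ : ∀ j → suc v ≤ level (2 + j)
  level-≥ j = m+k≡n⇒m≤n (w + v' + j * v) (lemma w v' (j * v))
    where lemma : ∀ w v' jv → suc (suc v') + (w + v' + jv) ≡ w + (suc v' + (suc v' + jv))
          lemma = ℕ-Solver.solve-∀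

  level-suc : ∀ p → level (suc p) ≡ level p + v
  level-suc p = lemma w v (p * v)
    where lemma : ∀ w v pv → w + (v + pv) ≡ w + pv + v
          lemma = ℕ-Solver.solve-∀

  mγ̃^-factor : ∀ {L} → suc v ≤ L → ∀ p → + m *ᶻ γ̃ L ^ᶻ p ≡ 2^ᶻ (level p) *ᶻ (+ o *ᶻ oddPart L ^ᶻ p)
  mγ̃^-factor {L} v<L p = begin
    + m *ᶻ γ̃ L ^ᶻ p                                   ≡⟨ cong₂ _*ᶻ_ m≡ (γ̃^-factor v<L p) ⟩
    2^ᶻ w *ᶻ + o *ᶻ (2^ᶻ (p * v) *ᶻ oddPart L ^ᶻ p)   ≡⟨ lemma (2^ᶻ w) (+ o) (2^ᶻ (p * v)) (oddPart L ^ᶻ p) ⟩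
    2^ᶻ w *ᶻ 2^ᶻ (p * v) *ᶻ (+ o *ᶻ oddPart L ^ᶻ p)   ≡⟨ cong (_*ᶻ (+ o *ᶻ oddPart L ^ᶻ p)) (2^ᶻ-+ w (p * v)) ⟨
    2^ᶻ (level p) *ᶻ (+ o *ᶻ oddPart L ^ᶻ p)         ∎
    where
    open ≡-Reasoning
    m≡ : + m ≡ 2^ᶻ w *ᶻ + o
    m≡ = trans (cong +_ (trans m≡o*2^w (ℕ.*-comm o (2 ^ w))))
               (trans (ℤ.pos-* (2 ^ w) o) (cong (_*ᶻ + o) (sym (2^ᶻ-pos w))))
    lemma : ∀ W o P g → W *ᶻ o *ᶻ (P *ᶻ g) ≡ W *ᶻ P *ᶻ (o *ᶻ g)
    lemma = solve-∀

  cofactor-^-step : ∀ {L} → suc v ≤ L → ∀ D {i} → i < K → ∀ j →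
    (cofactor L D i (2 + j) +ᶻ γ̃ L ^ᶻ (2 + j)) ^ᶻ m ≡
      cofactor L D i (2 + j) ^ᶻ m +ᶻ + m *ᶻ γ̃ L ^ᶻ (2 + j) [mod2^ level (3 + j) ]
  cofactor-^-step {L} v<L D {i} i<K j =
    mod-weaken level≤ (subst (λ n → (B +ᶻ h) ^ᶻ n ≡ B ^ᶻ n +ᶻ + n *ᶻ h [mod2^ ((2 + j) * v + w + (v' + v)) ])
                             (sym (trans m≡o*2^w (ℕ.*-comm o (2 ^ w))))
                             (^-+-linear-2^ 2v≤s (cofactor≡1 v<L D i<K j) (γ̃^-divisible v<L (2 + j)) w o))
    where
    B h : ℤ
    B = cofactor L D i (2 + j)
    h = γ̃ L ^ᶻ (2 + j)
    2v≤s : v + v ≤ (2 + j) * v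
    2v≤s = ℕ.+-monoʳ-≤ v (ℕ.m≤m+n v (j * v))
    level≤ : level (3 + j) ≤ (2 + j) * v + w + (v' + v)
    level≤ = m+k≡n⇒m≤n v' (lemma w v' (j * v))
      where lemma : ∀ w v' jv → w + (suc v' + (suc v' + (suc v' + jv))) + v' ≡ suc v' + (suc v' + jv) + w + (v' + suc v')
            lemma = ℕ-Solver.solve-∀

  sum-^-step : ∀ {L} → suc v ≤ L → ∀ D j → D j ≤ K →
    sumᶻ K (λ i → cofactor L D i (3 + j) ^ᶻ m) ≡
      sumᶻ K (λ i → cofactor L D i (2 + j) ^ᶻ m) +ᶻ + D j *ᶻ (+ m *ᶻ γ̃ L ^ᶻ (2 + j)) [mod2^ level (3 + j) ]
  sum-^-step {L} v<L D j Dj≤K = begin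
    sumᶻ K (λ i → (B i +ᶻ when (does (i <? D j)) h) ^ᶻ m)        ≈⟨ sumᶻ-cong-mod K (λ i i<K → term i i<K (i <? D j)) ⟩
    sumᶻ K (λ i → B i ^ᶻ m +ᶻ when (does (i <? D j)) (+ m *ᶻ h)) ≡⟨ sumᶻ-+ K _ _ ⟩
    sumᶻ K (λ i → B i ^ᶻ m) +ᶻ sumᶻ K (λ i → when (does (i <? D j)) (+ m *ᶻ h))
                                                  ≡⟨ cong (sumᶻ K (λ i → B i ^ᶻ m) +ᶻ_) (sumᶻ-indicator K (D j) _ Dj≤K) ⟩
    sumᶻ K (λ i → B i ^ᶻ m) +ᶻ + D j *ᶻ (+ m *ᶻ h)              ∎
    where
    open ≡-mod-Reasoning (level (3 + j))
    B : ℕ → ℤ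
    B i = cofactor L D i (2 + j)
    h : ℤ
    h = γ̃ L ^ᶻ (2 + j)
    term : ∀ i → i < K → (i<d : Dec (i < D j)) →
      (B i +ᶻ when (does i<d) h) ^ᶻ m ≡ B i ^ᶻ m +ᶻ when (does i<d) (+ m *ᶻ h) [mod2^ level (3 + j) ]
    term i i<K (yes _) = cofactor-^-step v<L D i<K j
    term i i<K (no _)  = mod-reflexive (trans (cong (_^ᶻ m) (ℤ.+-identityʳ (B i))) (sym (ℤ.+-identityʳ (B i ^ᶻ m))))

  ω : ℕ → ℤ
  ω j = γ̃-1 L ^ᶻ m *ᶻ (+ o *ᶻ oddPart L ^ᶻ (2 + j))
    where L = level (3 + j)

  ω-odd : ∀ j → Odd (ω j)
  ω-odd j = odd-* (odd-^ m (γ̃-1-odd (level-≥ (suc j)))) (odd-* o-odd (odd-^ (2 + j) (oddPart-odd (level (3 + j)))))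

  powerSum-step : ∀ c D j → D j ≤ K →
    powerSum c (level (3 + j)) D (3 + j) ≡
      powerSum c (level (3 + j)) D (2 + j) +ᶻ + D j *ᶻ 2^ᶻ (level (2 + j)) *ᶻ ω j [mod2^ level (3 + j) ]
  powerSum-step c D j Dj≤K = begin
    Uᵐ *ᶻ (+ c +ᶻ S (3 + j))                        ≈⟨ *-congˡ-mod Uᵐ (+-congˡ-mod (+ c) (sum-^-step v<L D j Dj≤K)) ⟩
    Uᵐ *ᶻ (+ c +ᶻ (S (2 + j) +ᶻ + D j *ᶻ (+ m *ᶻ h))) ≡⟨ cong (λ z → Uᵐ *ᶻ (+ c +ᶻ (S (2 + j) +ᶻ z))) (cong (+ D j *ᶻ_) mh≡) ⟩
    Uᵐ *ᶻ (+ c +ᶻ (S (2 + j) +ᶻ + D j *ᶻ (P *ᶻ q)))   ≡⟨ lemma Uᵐ (+ c) (S (2 + j)) (+ D j) P q ⟩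
    Uᵐ *ᶻ (+ c +ᶻ S (2 + j)) +ᶻ + D j *ᶻ P *ᶻ ω j    ∎
    where
    open ≡-mod-Reasoning (level (3 + j))
    L : ℕ
    L = level (3 + j)
    v<L : suc v ≤ L
    v<L = level-≥ (suc j)
    Uᵐ h P q : ℤ
    Uᵐ = γ̃-1 L ^ᶻ m
    h = γ̃ L ^ᶻ (2 + j)
    P = 2^ᶻ (level (2 + j))
    q = + o *ᶻ oddPart L ^ᶻ (2 + j)
    mh≡ : + m *ᶻ h ≡ P *ᶻ q
    mh≡ = mγ̃^-factor v<L (2 + j)
    S : ℕ → ℤ
    S p = sumᶻ K (λ i → cofactor L D i p ^ᶻ m)
    lemma : ∀ U c S d P q → U *ᶻ (c +ᶻ (S +ᶻ d *ᶻ (P *ᶻ q))) ≡ U *ᶻ (c +ᶻ S) +ᶻ d *ᶻ P *ᶻ (U *ᶻ q)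
    lemma = solve-∀

  sum-cofactor-two : ∀ L D → sumᶻ K (λ i → cofactor L D i 2 ^ᶻ m) ≡ + K
  sum-cofactor-two L D = begin
    sumᶻ K (λ i → cofactor L D i 2 ^ᶻ m) ≡⟨ sumᶻ-cong K (λ i i<K → cofactor-two^m i<K) ⟩
    sumᶻ K (λ _ → + 1)                   ≡⟨ sumᶻ-const K (+ 1) ⟩
    + K *ᶻ + 1                           ≡⟨ ℤ.*-identityʳ (+ K) ⟩
    + K                                  ∎
    where
    open ≡-Reasoning
    cofactor-two^m : ∀ {i} → i < K → cofactor L D i 2 ^ᶻ m ≡ + 1
    cofactor-two^m i<K = trans (cong (_^ᶻ m) (cofactor-two L D i<K)) (ℤ.^-zeroˡ m)

  powerSum-truncate : ∀ c D N → powerSum c N D (2 + N) ≡ powerSum c N D N [mod2^ N ]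
  powerSum-truncate c D N = *-congˡ-mod (γ̃-1 N ^ᶻ m) (+-congˡ-mod (+ c)
    (sumᶻ-cong-mod K (λ i _ → ^-cong-mod m (cofactor-truncate D i N 2))))

  K' k : ℕ
  K' = 2 ^ level 2 ∸ 1
  k  = K + K'

  1≤k : 1 ≤ k
  1≤k = ℕ.≤-trans (ℕ.<⇒≤pred (ℕ.^-monoʳ-≤ 2 {1} {v} (s≤s z≤n))) (ℕ.m≤m+n K K')

  k≡bound : k ≡ 2 ^ v * (2 ^ (v + w) + 1) ∸ 2
  k≡bound = sym (begin
    2 ^ v * (2 ^ (v + w) + 1) ∸ 2          ≡⟨ cong (_∸ 2) (ℕ.*-distribˡ-+ (2 ^ v) (2 ^ (v + w)) 1) ⟩
    2 ^ v * 2 ^ (v + w) + 2 ^ v * 1 ∸ 2    ≡⟨ cong₂ (λ a b → a + b ∸ 2) 2^level (ℕ.*-identityʳ (2 ^ v)) ⟩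
    2 ^ level 2 + 2 ^ v ∸ 2                ≡⟨ cong₂ (λ a b → a + b ∸ 2) (sym (suc-pred-2^ (level 2))) (sym (suc-pred-2^ v)) ⟩
    suc K' + suc K ∸ 2                     ≡⟨ cong (_∸ 1) (ℕ.+-suc K' K) ⟩
    K' + K                                 ≡⟨ ℕ.+-comm K' K ⟩
    K + K'                                 ∎)
    where
    open ≡-Reasoning
    suc-pred-2^ : ∀ n → suc (2 ^ n ∸ 1) ≡ 2 ^ n
    suc-pred-2^ n = ℕ.suc-pred (2 ^ n) {{ℕ.m^n≢0 2 n}}
    2^level : 2 ^ v * 2 ^ (v + w) ≡ 2 ^ level 2
    2^level = trans (sym (ℕ.^-distribˡ-+-* 2 v (v + w))) (cong (2 ^_) (lemma v w))
      where lemma : ∀ v w → v + (v + w) ≡ w + (v + (v + 0))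
            lemma = ℕ-Solver.solve-∀

  module Representation (x : ℤ₂) where

    x̃ : ℕ → ℤ
    x̃ L = + res x L

    c : ℕ
    c = divOdd (level 2) 0 (γ̃-1 (level 2) ^ᶻ m) (x̃ (level 2) -ᶻ γ̃-1 (level 2) ^ᶻ m *ᶻ + K)

    nextDigit : ℕ → (ℕ → ℕ) → ℕ
    nextDigit j D = divOdd v (level (2 + j)) (ω j) (x̃ (level (3 + j)) -ᶻ powerSum c (level (3 + j)) D (2 + j))

    prefix : ℕ → ℕ → ℕ
    prefix zero    n = 0
    prefix (suc j) n = if does (n ≟ j) then nextDigit j (prefix j) else prefix j n

    digit : ℕ → ℕ
    digit n = prefix (suc n) n

    prefix-stable : ∀ {j n} → n < j → prefix j n ≡ digit n
    prefix-stable {suc j} {n} n<1+j with ℕ.m≤n⇒m<n∨m≡n (ℕ.≤-pred n<1+j)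
    ... | inj₂ refl = refl
    ... | inj₁ n<j rewrite dec-false (n ≟ j) (ℕ.<⇒≢ n<j) = prefix-stable n<j

    digit-next : ∀ j → digit j ≡ nextDigit j (prefix j)
    digit-next j rewrite dec-true (j ≟ j) refl = refl

    digit≤K : ∀ j → digit j ≤ K
    digit≤K j = subst (_≤ K) (sym (digit-next j)) (ℕ.<⇒≤pred (divOdd<2^ v _ _ _))

    c≤K' : c ≤ K'
    c≤K' = ℕ.<⇒≤pred (divOdd<2^ (level 2) 0 _ _)

    x̃-coherent : Coherent x̃
    x̃-coherent = res-coherent x

    invariant-base : powerSum c (level 2) digit 2 ≡ x̃ (level 2) [mod2^ level 2 ]
    invariant-base = begin
      Uᵐ *ᶻ (+ c +ᶻ sumᶻ K (λ i → cofactor L digit i 2 ^ᶻ m))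
        ≡⟨ cong (λ S → Uᵐ *ᶻ (+ c +ᶻ S)) (sum-cofactor-two L digit) ⟩
      Uᵐ *ᶻ (+ c +ᶻ + K)
        ≡⟨ lemma Uᵐ (+ c) (+ K) ⟩
      Uᵐ *ᶻ + K +ᶻ + c *ᶻ + 1 *ᶻ Uᵐ
        ≡⟨ cong (λ P → Uᵐ *ᶻ + K +ᶻ + c *ᶻ P *ᶻ Uᵐ) (2^ᶻ-pos 0) ⟨
      Uᵐ *ᶻ + K +ᶻ + c *ᶻ 2^ᶻ 0 *ᶻ Uᵐ
        ≈⟨ mod-sym (divOdd-lifts L 0 Uᵐ-odd (mod2^0 (x̃ L) (Uᵐ *ᶻ + K))) ⟩
      x̃ L ∎
      where
      open ≡-mod-Reasoning (level 2)
      L : ℕ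
      L = level 2
      Uᵐ : ℤ
      Uᵐ = γ̃-1 L ^ᶻ m
      Uᵐ-odd : Odd Uᵐ
      Uᵐ-odd = odd-^ m (γ̃-1-odd (level-≥ 0))
      lemma : ∀ U c K → U *ᶻ (c +ᶻ K) ≡ U *ᶻ K +ᶻ c *ᶻ + 1 *ᶻ U
      lemma = solve-∀

    invariant : ∀ j → powerSum c (level (2 + j)) digit (2 + j) ≡ x̃ (level (2 + j)) [mod2^ level (2 + j) ]
    invariant zero    = invariant-base
    invariant (suc j) = begin
      powerSum c L' digit (3 + j)
        ≈⟨ powerSum-step c digit j (digit≤K j) ⟩
      powerSum c L' digit (2 + j) +ᶻ + digit j *ᶻ 2^ᶻ L *ᶻ ω j
        ≡⟨ cong₂ (λ P d → P +ᶻ + d *ᶻ 2^ᶻ L *ᶻ ω j) digit≡prefix (digit-next j) ⟩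
      powerSum c L' (prefix j) (2 + j) +ᶻ + nextDigit j (prefix j) *ᶻ 2^ᶻ L *ᶻ ω j
        ≈⟨ mod-sym (mod-cast (sym (level-suc (2 + j))) (divOdd-lifts v L (ω-odd j) x≡prefix)) ⟩
      x̃ L' ∎
      where
      open ≡-mod-Reasoning (level (3 + j))
      L L' : ℕ
      L  = level (2 + j)
      L' = level (3 + j)
      L≤L' : L ≤ L'
      L≤L' = ℕ.≤-trans (ℕ.m≤m+n L v) (ℕ.≤-reflexive (sym (level-suc (2 + j))))
      digit≡prefix : powerSum c L' digit (2 + j) ≡ powerSum c L' (prefix j) (2 + j)
      digit≡prefix = powerSum-ext c L' j (λ n n<j → sym (prefix-stable n<j))
      x≡prefix : x̃ L' ≡ powerSum c L' (prefix j) (2 + j) [mod2^ L ]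
      x≡prefix = mod-trans (x̃-coherent L≤L') (mod-trans (mod-sym (invariant j))
                   (mod-trans (mod-sym (powerSum-coherent c digit (2 + j) L≤L')) (mod-reflexive digit≡prefix)))

    constDigits : ℕ → ℕ → Bool
    constDigits l zero    = does (l <? c)
    constDigits l (suc _) = false

    summand : Fin K ⊎ Fin K' → ℕ → Bool
    summand = [ (λ i → principalDigits digit (toℕ i)) , (λ l → constDigits (toℕ l)) ]′

    xs : Fin k → ℕ → Bool
    xs i = summand (splitAt K i)

    sumFin-xs : ∀ (F : (ℕ → Bool) → ℕ) →
      sumFin k (λ i → F (xs i)) ≡ sumBelow K (λ i → F (principalDigits digit i)) + sumBelow K' (λ l → F (constDigits l))
    sumFin-xs F = begin
      sumFin k (λ i → F (xs i))
        ≡⟨ sumFin-++ K K' _ ⟩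
      sumFin K (λ i → F (xs (i ↑ˡ K'))) + sumFin K' (λ l → F (xs (K ↑ʳ l)))
        ≡⟨ cong₂ _+_ (sumFin-cong K (λ i → cong (λ s → F (summand s)) (splitAt-↑ˡ K i K')))
                     (sumFin-cong K' (λ l → cong (λ s → F (summand s)) (splitAt-↑ʳ K K' l))) ⟩
      sumFin K (λ i → F (principalDigits digit (toℕ i))) + sumFin K' (λ l → F (constDigits (toℕ l)))
        ≡⟨ cong₂ _+_ (sumFin-toℕ K _) (sumFin-toℕ K' _) ⟩
      sumBelow K (λ i → F (principalDigits digit i)) + sumBelow K' (λ l → F (constDigits l)) ∎
      where open ≡-Reasoning

    Cval^m-≡-mod : ∀ b N →
      + (Cval γ b N ^ m) ≡ γ̃-1 N ^ᶻ m *ᶻ sumᶻ N (λ t → when (b t) (γ̃ N ^ᶻ t)) ^ᶻ m [mod2^ N ]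
    Cval^m-≡-mod b N = mod-trans (mod-reflexive (pos-^ (Cval γ b N) m))
      (mod-trans (^-cong-mod m (Cval-≡-mod γ b N)) (mod-reflexive (^-distribʳ-* (γ̃-1 N) _ m)))

    principal-summands : ∀ N → + sumBelow K (λ i → Cval γ (principalDigits digit i) N ^ m) ≡
      γ̃-1 N ^ᶻ m *ᶻ sumᶻ K (λ i → cofactor N digit i N ^ᶻ m) [mod2^ N ]
    principal-summands N = begin
      + sumBelow K (λ i → Cval γ (principalDigits digit i) N ^ m)
        ≡⟨ sumBelow-pos K _ ⟩
      sumᶻ K (λ i → + (Cval γ (principalDigits digit i) N ^ m))
        ≈⟨ sumᶻ-cong-mod K (λ i _ → Cval^m-≡-mod (principalDigits digit i) N) ⟩
      sumᶻ K (λ i → γ̃-1 N ^ᶻ m *ᶻ cofactor N digit i N ^ᶻ m)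
        ≡⟨ *-distribˡ-sumᶻ (γ̃-1 N ^ᶻ m) K _ ⟨
      γ̃-1 N ^ᶻ m *ᶻ sumᶻ K (λ i → cofactor N digit i N ^ᶻ m) ∎
      where open ≡-mod-Reasoning N

    const-summands : ∀ N' → let N = suc N' in
      + sumBelow K' (λ l → Cval γ (constDigits l) N ^ m) ≡ + c *ᶻ γ̃-1 N ^ᶻ m [mod2^ N ]
    const-summands N' = begin
      + sumBelow K' (λ l → Cval γ (constDigits l) N ^ m)      ≡⟨ sumBelow-pos K' _ ⟩
      sumᶻ K' (λ l → + (Cval γ (constDigits l) N ^ m))        ≈⟨ sumᶻ-cong-mod K' (λ l _ → Cval^m-≡-mod _ N) ⟩
      sumᶻ K' (λ l → γ̃-1 N ^ᶻ m *ᶻ digitSum l ^ᶻ m)           ≡⟨ sumᶻ-cong K' (λ l _ → term l) ⟩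
      sumᶻ K' (λ l → when (does (l <? c)) (γ̃-1 N ^ᶻ m))       ≡⟨ sumᶻ-indicator K' c _ c≤K' ⟩
      + c *ᶻ γ̃-1 N ^ᶻ m                                      ∎
      where
      open ≡-mod-Reasoning (suc N')
      N : ℕ
      N = suc N'
      digitSum : ℕ → ℤ
      digitSum l = sumᶻ N (λ t → when (constDigits l t) (γ̃ N ^ᶻ t))
      term : ∀ l → γ̃-1 N ^ᶻ m *ᶻ digitSum l ^ᶻ m ≡ when (does (l <? c)) (γ̃-1 N ^ᶻ m)
      term l = trans (cong (λ z → γ̃-1 N ^ᶻ m *ᶻ z ^ᶻ m) (sumᶻ-single N' _ (λ _ → refl))) (indicator-^ (does (l <? c)))
        where
        indicator-^ : ∀ b → γ̃-1 N ^ᶻ m *ᶻ when b (+ 1) ^ᶻ m ≡ when b (γ̃-1 N ^ᶻ m)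
        indicator-^ true  = trans (cong (γ̃-1 N ^ᶻ m *ᶻ_) (ℤ.^-zeroˡ m)) (ℤ.*-identityʳ (γ̃-1 N ^ᶻ m))
        indicator-^ false = ℤ.*-zeroʳ (γ̃-1 N ^ᶻ m)

    powerSum≡x̃ : ∀ N → powerSum c N digit N ≡ x̃ N [mod2^ N ]
    powerSum≡x̃ N = begin
      powerSum c N digit N                     ≈⟨ mod-sym (powerSum-truncate c digit N) ⟩
      powerSum c N digit (2 + N)               ≈⟨ mod-sym (powerSum-coherent c digit (2 + N) N≤L) ⟩
      powerSum c (level (2 + N)) digit (2 + N) ≈⟨ mod-weaken N≤L (invariant N) ⟩
      x̃ (level (2 + N))                        ≈⟨ x̃-coherent N≤L ⟩
      x̃ N                                      ∎
      where
      open ≡-mod-Reasoning N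
      N≤L : N ≤ level (2 + N)
      N≤L = ℕ.≤-trans (ℕ.m≤m*n N v) (m+k≡n⇒m≤n (w + (v + v)) (lemma (N * v) w v))
        where lemma : ∀ Nv w v → Nv + (w + (v + v)) ≡ w + (v + (v + Nv))
              lemma = ℕ-Solver.solve-∀

    represents : ∀ N → + sumFin k (λ i → Cval γ (xs i) N ^ m) ≡ x̃ N [mod2^ N ]
    represents zero     = mod2^0 _ _
    represents (suc N') = begin
      + sumFin k (λ i → Cval γ (xs i) N ^ m)               ≡⟨ cong +_ (sumFin-xs (λ b → Cval γ b N ^ m)) ⟩
      + (principal + const)                                ≡⟨ ℤ.pos-+ principal const ⟩
      + principal +ᶻ + const                               ≈⟨ +-cong-mod (principal-summands N) (const-summands N') ⟩
      Uᵐ *ᶻ sumᶻ K (λ i → cofactor N digit i N ^ᶻ m) +ᶻ + c *ᶻ Uᵐ ≡⟨ lemma Uᵐ _ (+ c) ⟩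
      powerSum c N digit N                                 ≈⟨ powerSum≡x̃ N ⟩
      x̃ N                                                  ∎
      where
      open ≡-mod-Reasoning (suc N')
      N principal const : ℕ
      N = suc N'
      principal = sumBelow K (λ i → Cval γ (principalDigits digit i) N ^ m)
      const     = sumBelow K' (λ l → Cval γ (constDigits l) N ^ m)
      Uᵐ : ℤ
      Uᵐ = γ̃-1 N ^ᶻ m
      lemma : ∀ U S c → U *ᶻ S +ᶻ c *ᶻ U ≡ U *ᶻ (c +ᶻ S)
      lemma = solve-∀

    represents-res : ∀ N → sumFin k (λ i → Cval γ (xs i) N ^ m) mod2^ N ≡ res x N
    represents-res N = trans (≡-mod⇒mod2^-≡ _ _ (represents N)) (res-mod2^ x ℕ.≤-refl)

theorem7p2 : (γ : ℤ₂) (v : ℕ) → HasVal₂ γ v → 2 ≤ v →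
    (m : ℕ) → 2 ≤ m → (w : ℕ) → NatVal₂ m w →
    Σ ℕ (λ k → (1 ≤ k) × (k ≤ 2 ^ v * (2 ^ (v + w) + 1) ∸ 2) ×
      ((x : ℤ₂) → Σ (Fin k → (ℕ → Bool)) (λ xs →
        (N : ℕ) → sumFin k (λ i → Cval γ (xs i) N ^ m) mod2^ N ≡ res x N)))
-- The construction only needs v ≥ 1 and m ≥ 1.
theorem7p2 γ (suc v') γ-val (s≤s _) (suc m') (s≤s _) w m-val =
  k , 1≤k , ℕ.≤-reflexive k≡bound , λ x → Representation.xs x , Representation.represents-res x
  where open Construction γ v' γ-val m' w m-val
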